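{- Let $a\in\hat A$. The group $S'_a$ is a normal subgroup of $S_{\bar a}$ and the short exact sequence \[1\to S'_a\to S_{\bar a}\to S_{\bar a}/S'_a\to 1\] splits.
   Context: Let $n\ge 3$. Let $\hat{A}=\{(a_1,\dots,a_n)\in(\mathbb{Z}/n\mathbb{Z})^n:\sum a_i=0\}/\{(a,\dots,a)\}$ with classes $[a_1,\dots,a_n]$. $\mathfrak{S}_n$ acts on $\hat A$ by ${}^\sigma[a_1,\dots,a_n]=[a_{\sigma^{ -1}(1)},\dots,a_{\sigma^{ -1}(n)}]$ and $(\mathbb{Z}/n\mathbb{Z})^\times$ acts by $k[a_1,\dots,a_n]=[ka_1,\dots,ka_n]$. For $a=[a_1,\dots,a_n]\in\hat A$: $S'_a\subset\mathfrak{S}_n$ is the fixator of the tuple $(a_1,\dots,a_n)\in(\mathbb{Z}/n\mathbb{Z})^n$ (independent of the representative), and $S_{\bar a}$ is the stabilizer in $\mathfrak{S}_n$ of the class of $a$ modulo the action of $(\mathbb{Z}/n\mathbb{Z})^\times$. -}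

module Defs where

open import Data.Nat using (ℕ; _+_; _*_; NonZero)
open import Data.Nat.DivMod using (_%_)
open import Data.Nat.Coprimality using (Coprime)
open import Data.Fin using (Fin)
open import Data.Nat.ListAction using (sum)
open import Data.Fin.Permutation using (Permutation′; _⟨$⟩ˡ_; _∘ₚ_; flip; _≈_)
open import Data.Product using (Σ; _×_; ∃)
open import Relation.Binary.PropositionalEquality using (_≡_)
import Data.List as L

-- Elements of ℤ/nℤ are represented by natural numbers, compared modulo n.
_≡_[mod_] : ℕ → ℕ → (n : ℕ) → .{{NonZero n}} → Set
x ≡ y [mod n ] = x % n ≡ y % n

-- A tuple (a₁,…,aₙ) ∈ (ℤ/nℤ)ⁿ, given by representatives.
Tuple : ℕ → Set
Tuple n = Fin n → ℕ

-- The tuple has sum 0 in ℤ/nℤ, i.e. it represents an element of Â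
-- (Â-classes are handled by the relation ClassEq below).
SumZero : (n : ℕ) → .{{NonZero n}} → Tuple n → Set
SumZero n a = sum (L.tabulate a) ≡ 0 [mod n ]

-- [a] = [b] in Â : they differ by a constant tuple (c,…,c).
ClassEq : (n : ℕ) → .{{NonZero n}} → Tuple n → Tuple n → Set
ClassEq n a b = Σ ℕ λ c → ∀ i → a i ≡ b i + c [mod n ]

act : {n : ℕ} → Permutation′ n → Tuple n → Tuple n
act σ a i = a (σ ⟨$⟩ˡ i)

scale : {n : ℕ} → ℕ → Tuple n → Tuple n
scale k a i = k * a i

S' : (n : ℕ) → .{{NonZero n}} → Tuple n → Permutation′ n → Set
S' n a σ = ∀ i → act σ a i ≡ a i [mod n ]

-- S_ā : stabilizer of the (ℤ/nℤ)ˣ-orbit of [a] ∈ Â,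
-- i.e. σ with ˢ[a] = k[a] in Â for some unit k.
Sbar : (n : ℕ) → .{{NonZero n}} → Tuple n → Permutation′ n → Set
Sbar n a σ = Σ ℕ λ k → Coprime k n × ClassEq n (act σ a) (scale k a)

-- N is a normal subgroup of G (N is already known to be a subgroup of 𝔖ₙ):
-- N ⊆ G and N is closed under conjugation by elements of G.
IsNormalIn : {n : ℕ} → (Permutation′ n → Set) → (Permutation′ n → Set) → Set
IsNormalIn N G =
  (∀ τ → N τ → G τ) ×
  (∀ σ τ → G σ → N τ → N (flip σ ∘ₚ τ ∘ₚ σ))

-- The sequence 1 → N → G → G/N → 1 splits: there is a group homomorphism
-- s : G/N → G with π ∘ s = id.  Elements of G/N are represented by elements
-- of G, identified when they lie in the same coset; e σ stands for s(σN).
Splits : {n : ℕ} → (Permutation′ n → Set) → (Permutation′ n → Set) → Set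
Splits {n} N G = Σ (Permutation′ n → Permutation′ n) λ e →
  (∀ σ → G σ → G (e σ)) ×
  -- s is well defined on G/N
  (∀ σ τ → G σ → G τ → N (flip σ ∘ₚ τ) → e σ ≈ e τ) ×
  (∀ σ τ → G σ → G τ → e (σ ∘ₚ τ) ≈ e σ ∘ₚ e τ) ×
  -- π ∘ s = id on G/N
  (∀ σ → G σ → N (flip (e σ) ∘ₚ σ))

module Submission where

-- Reduce a modulo n to a colouring A of Fin n.  Then S'_a is the group of permutations
-- fixing A, and every σ ∈ S_ā preserves the partition of Fin n into colour classes:
-- ˢ[a] = k[a] + c with k a unit, and u ↦ k u + c is injective on ℤ/nℤ.
-- The splitting is the "stable rearrangement": among all π with A ∘ π = A ∘ σ there is
-- exactly one that keeps equally coloured points in their original relative order.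

open import Defs

open import Data.Nat using (ℕ; zero; suc; _+_; _*_; _∸_; _≤_; _<_; z≤n; s≤s; s<s⁻¹; NonZero; _≟_)
open import Data.Nat.Properties
  using (+-0-commutativeMonoid; +-monoʳ-<; <-irrefl; m+n∸m≡n; [m+n]∸[m+o]≡n∸o; *-distribʳ-∸;
         m+[n∸m]≡n; ≤-total; +-identityʳ; *-identityˡ)
open import Data.Nat.Tactic.RingSolver using (solve-∀)
open import Algebra.Properties.CommutativeMonoid.Sum +-0-commutativeMonoid using (sum; sum-permute)
open import Data.Nat.Divisibility using (_∣_; divides)
open import Data.Nat.DivMod using (_%_; _/_; m≡m%n+[m/n]*n; %-remove-+ʳ; %-distribˡ-+; %-distribˡ-*)
open import Data.Nat.Coprimality using (Coprime; coprime-divisor; 1-coprimeTo)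
import Data.Nat.Coprimality as Coprimality
open import Data.Fin using (Fin; zero; suc; toℕ)
open import Data.Fin.Properties using (<-cmp)
open import Data.Fin.Permutation
  using (Permutation′; permutation; _⟨$⟩ʳ_; _⟨$⟩ˡ_; _∘ₚ_; flip; _≈_; inverseˡ; inverseʳ)
open import Data.Product using (Σ; _×_; _,_; proj₁; proj₂)
open import Data.Sum using (inj₁; inj₂)
open import Function using (_∘_)
open import Relation.Binary.Definitions using (tri<; tri≈; tri>)
open import Relation.Binary.PropositionalEquality
open import Relation.Nullary using (yes; no; ¬_; contradiction)

private
  variable
    n : ℕ

Colouring : ℕ → Set
Colouring n = Fin n → ℕ

δ : ℕ → ℕ → ℕ
δ x v with x ≟ v
... | yes _ = 1
... | no _  = 0

δ-yes : {x v : ℕ} → x ≡ v → δ x v ≡ 1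
δ-yes {x} {v} x≡v with x ≟ v
... | yes _  = refl
... | no x≢v = contradiction x≡v x≢v

δ-no : {x v : ℕ} → ¬ x ≡ v → δ x v ≡ 0
δ-no {x} {v} x≢v with x ≟ v
... | yes x≡v = contradiction x≡v x≢v
... | no _    = refl

δ-cong : {x v y w : ℕ} → (x ≡ v → y ≡ w) → (y ≡ w → x ≡ v) → δ x v ≡ δ y w
δ-cong {x} {v} {y} {w} to from with x ≟ v | y ≟ w
... | yes _   | yes _   = refl
... | no _    | no _    = refl
... | yes x≡v | no y≢w  = contradiction (to x≡v) y≢w
... | no x≢v  | yes y≡w = contradiction (from y≡w) x≢v

count : Colouring n → ℕ → ℕ
count d v = sum (λ x → δ (d x) v)

count-permute : (d : Colouring n) (σ : Permutation′ n) (v : ℕ) →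
  count (λ x → d (σ ⟨$⟩ʳ x)) v ≡ count d v
count-permute d σ v = sym (sum-permute (λ x → δ (d x) v) σ)

before : Colouring n → ℕ → Fin n → ℕ
before d v zero    = 0
before d v (suc j) = δ (d zero) v + before (d ∘ suc) v j

rank : Colouring n → Fin n → ℕ
rank d j = before d (d j) j

before<count : (d : Colouring n) (v : ℕ) (j : Fin n) → d j ≡ v → before d v j < count d v
before<count d v zero    dj≡v rewrite δ-yes dj≡v = s≤s z≤n
before<count d v (suc j) dj≡v = +-monoʳ-< (δ (d zero) v) (before<count (d ∘ suc) v j dj≡v)

before-strictMono : (d : Colouring n) (v : ℕ) (i j : Fin n) → toℕ i < toℕ j → d i ≡ v →
  before d v i < before d v j
before-strictMono d v zero    (suc j) _   d₀≡v rewrite δ-yes d₀≡v = s≤s z≤n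
before-strictMono d v (suc i) (suc j) i<j di≡v =
  +-monoʳ-< (δ (d zero) v) (before-strictMono (d ∘ suc) v i j (s<s⁻¹ i<j) di≡v)

rank-strictMono : (d : Colouring n) (i j : Fin n) → toℕ i < toℕ j → d i ≡ d j → rank d i < rank d j
rank-strictMono d i j i<j di≡dj =
  subst (λ w → before d (d i) i < before d w j) di≡dj (before-strictMono d (d i) i j i<j refl)

rank-injective : (d : Colouring n) (i j : Fin n) → d i ≡ d j → rank d i ≡ rank d j → i ≡ j
rank-injective d i j di≡dj ri≡rj with <-cmp i j
... | tri≈ _ i≡j _ = i≡j
... | tri< i<j _ _ = contradiction (rank-strictMono d i j i<j di≡dj) (<-irrefl ri≡rj)
... | tri> _ _ j<i = contradiction (rank-strictMono d j i j<i (sym di≡dj)) (<-irrefl (sym ri≡rj))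

point-of-rank : (d : Colouring n) (v r : ℕ) → r < count d v →
  Σ (Fin n) λ j → d j ≡ v × before d v j ≡ r
point-of-rank {zero}  d v r ()
point-of-rank {suc n} d v r r<count with d zero ≟ v
point-of-rank {suc n} d v zero    _       | yes d₀≡v = zero , d₀≡v , refl
point-of-rank {suc n} d v (suc r) r<count | yes d₀≡v =
  let j , dj≡v , before≡r = point-of-rank (d ∘ suc) v r (s<s⁻¹ r<count)
  in  suc j , dj≡v , cong₂ _+_ (δ-yes d₀≡v) before≡r
point-of-rank {suc n} d v r       r<count | no d₀≢v =
  let j , dj≡v , before≡r = point-of-rank (d ∘ suc) v r r<count
  in  suc j , dj≡v , cong₂ _+_ (δ-no d₀≢v) before≡r

SamePartition : Colouring n → Colouring n → Set
SamePartition c d = ∀ x y → (c x ≡ c y → d x ≡ d y) × (d x ≡ d y → c x ≡ c y)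

samePartition-sym : {c d : Colouring n} → SamePartition c d → SamePartition d c
samePartition-sym same x y = proj₂ (same x y) , proj₁ (same x y)

samePartition-pointwise : {c d : Colouring n} → (∀ x → c x ≡ d x) → SamePartition c d
samePartition-pointwise c≗d x y =
  (λ eq → trans (sym (c≗d x)) (trans eq (c≗d y))) , (λ eq → trans (c≗d x) (trans eq (sym (c≗d y))))

before-cong : (c d : Colouring n) (v w : ℕ) → (∀ x → (c x ≡ v → d x ≡ w) × (d x ≡ w → c x ≡ v)) →
  ∀ j → before c v j ≡ before d w j
before-cong c d v w same zero    = refl
before-cong c d v w same (suc j) =
  cong₂ _+_ (δ-cong (proj₁ (same zero)) (proj₂ (same zero)))
            (before-cong (c ∘ suc) (d ∘ suc) v w (same ∘ suc) j)

rank-cong : (c d : Colouring n) → SamePartition c d → ∀ j → rank c j ≡ rank d j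
rank-cong c d same j = before-cong c d (c j) (d j) (λ x → same x j) j

Partner : Colouring n → Colouring n → Fin n → Fin n → Set
Partner d c x y = d y ≡ c x × rank d y ≡ rank c x

partner-sym : (d c : Colouring n) {x y : Fin n} → Partner d c x y → Partner c d y x
partner-sym d c (colour , rk) = sym colour , sym rk

partner-unique : (d c : Colouring n) {x y y′ : Fin n} → Partner d c x y → Partner d c x y′ → y ≡ y′
partner-unique d c (colour , rk) (colour′ , rk′) =
  rank-injective d _ _ (trans colour (sym colour′)) (trans rk (sym rk′))

partner-exists : (d c : Colouring n) → (∀ v → count c v ≡ count d v) → ∀ x → Σ (Fin n) (Partner d c x)
partner-exists d c same-counts x with point-of-rank d (c x) (rank c x) rank<count
  where
  rank<count : rank c x < count d (c x)
  rank<count = subst (rank c x <_) (same-counts (c x)) (before<count c (c x) x refl)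
... | y , dy≡cx , before≡rank = y , dy≡cx , trans (cong (λ w → before d w y) dy≡cx) before≡rank

StableMatch : Colouring n → Colouring n → Permutation′ n → Set
StableMatch d c π = ∀ x → Partner d c x (π ⟨$⟩ʳ x)

stable-unique : (d c : Colouring n) (π π′ : Permutation′ n) →
  StableMatch d c π → StableMatch d c π′ → π ≈ π′
stable-unique d c _ _ match match′ x = partner-unique d c (match x) (match′ x)

stable-exists : (d c : Colouring n) → (∀ v → count c v ≡ count d v) →
  Σ (Permutation′ n) (StableMatch d c)
stable-exists {n} d c same-counts = permutation forward backward forward∘backward backward∘forward , forward-partner
  where
  forward : Fin n → Fin n
  forward x = proj₁ (partner-exists d c same-counts x)
  backward : Fin n → Fin n
  backward y = proj₁ (partner-exists c d (sym ∘ same-counts) y)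
  forward-partner : ∀ x → Partner d c x (forward x)
  forward-partner x = proj₂ (partner-exists d c same-counts x)
  backward-partner : ∀ y → Partner c d y (backward y)
  backward-partner y = proj₂ (partner-exists c d (sym ∘ same-counts) y)
  forward∘backward : ∀ y → forward (backward y) ≡ y
  forward∘backward y = partner-unique d c (forward-partner (backward y)) (partner-sym c d (backward-partner y))
  backward∘forward : ∀ x → backward (forward x) ≡ x
  backward∘forward x = partner-unique c d (backward-partner (forward x)) (partner-sym d c (forward-partner x))

module CanonicalSection {n : ℕ} (A : Colouring n) where

  Fixes : Permutation′ n → Set
  Fixes σ = ∀ i → A (σ ⟨$⟩ˡ i) ≡ A i

  Preserves : Permutation′ n → Set
  Preserves σ = SamePartition A (λ x → A (σ ⟨$⟩ʳ x))

  -- σ and τ lie in the same coset of the fixator iff they recolour A in the same way.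
  SameColouring : Permutation′ n → Permutation′ n → Set
  SameColouring σ τ = ∀ x → A (σ ⟨$⟩ʳ x) ≡ A (τ ⟨$⟩ʳ x)

  coset⇒sameColouring : (σ τ : Permutation′ n) → Fixes (flip σ ∘ₚ τ) → SameColouring σ τ
  coset⇒sameColouring σ τ fixes x =
    trans (cong (λ y → A (σ ⟨$⟩ʳ y)) (sym (inverseˡ τ))) (fixes (τ ⟨$⟩ʳ x))

  sameColouring⇒coset : (σ τ : Permutation′ n) → SameColouring σ τ → Fixes (flip σ ∘ₚ τ)
  sameColouring⇒coset σ τ same i = trans (same (τ ⟨$⟩ˡ i)) (cong A (inverseʳ τ))

  canonical : Permutation′ n → Permutation′ n
  canonical σ = proj₁ (stable-exists A (λ x → A (σ ⟨$⟩ʳ x)) (count-permute A σ))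

  canonical-stable : ∀ σ → StableMatch A (λ x → A (σ ⟨$⟩ʳ x)) (canonical σ)
  canonical-stable σ = proj₂ (stable-exists A (λ x → A (σ ⟨$⟩ʳ x)) (count-permute A σ))

  canonical-colour : ∀ σ → SameColouring (canonical σ) σ
  canonical-colour σ x = proj₁ (canonical-stable σ x)

  canonical-coset : (σ τ : Permutation′ n) → SameColouring σ τ → canonical σ ≈ canonical τ
  canonical-coset σ τ same =
    stable-unique A (λ x → A (σ ⟨$⟩ʳ x)) (canonical σ) (canonical τ) (canonical-stable σ) τ-match
    where
    τ-match : StableMatch A (λ x → A (σ ⟨$⟩ʳ x)) (canonical τ)
    τ-match x with canonical-stable τ x
    ... | colour , rk =
      trans colour (sym (same x)) ,
      trans rk (rank-cong _ _ (samePartition-pointwise (sym ∘ same)) x)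

  canonical-∘ : (σ τ : Permutation′ n) → Preserves τ →
    canonical (σ ∘ₚ τ) ≈ canonical σ ∘ₚ canonical τ
  canonical-∘ σ τ τ-preserves =
    stable-unique A (λ x → A (τ ⟨$⟩ʳ (σ ⟨$⟩ʳ x))) (canonical (σ ∘ₚ τ)) (canonical σ ∘ₚ canonical τ)
                  (canonical-stable (σ ∘ₚ τ)) composite-match
    where
    open ≡-Reasoning
    Aσ Aτ Aτσ : Colouring n
    Aσ x  = A (σ ⟨$⟩ʳ x)
    Aτ x  = A (τ ⟨$⟩ʳ x)
    Aτσ x = A (τ ⟨$⟩ʳ (σ ⟨$⟩ʳ x))
    e-σ : Fin n → Fin n
    e-σ x = canonical σ ⟨$⟩ʳ x
    composite-match : StableMatch A Aτσ (canonical σ ∘ₚ canonical τ)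
    composite-match x = colour , rk
      where
      colour : A (canonical τ ⟨$⟩ʳ e-σ x) ≡ Aτσ x
      colour = trans (canonical-colour τ (e-σ x))
                     (proj₁ (τ-preserves (e-σ x) (σ ⟨$⟩ʳ x)) (canonical-colour σ x))
      rk : rank A (canonical τ ⟨$⟩ʳ e-σ x) ≡ rank Aτσ x
      rk = begin
        rank A (canonical τ ⟨$⟩ʳ e-σ x) ≡⟨ proj₂ (canonical-stable τ (e-σ x)) ⟩
        rank Aτ (e-σ x)                 ≡⟨ rank-cong Aτ A (samePartition-sym τ-preserves) (e-σ x) ⟩
        rank A (e-σ x)                  ≡⟨ proj₂ (canonical-stable σ x) ⟩
        rank Aσ x                       ≡⟨ rank-cong Aσ Aτσ (λ y z → τ-preserves (σ ⟨$⟩ʳ y) (σ ⟨$⟩ʳ z)) x ⟩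
        rank Aτσ x                      ∎

  module _ (G : Permutation′ n → Set)
           (G-preserves : ∀ σ → G σ → Preserves σ)
           (G-cosets : ∀ σ τ → SameColouring σ τ → G σ → G τ) where

    fixator-normal : (∀ τ → Fixes τ → G τ) → IsNormalIn Fixes G
    fixator-normal fixes⊆G = fixes⊆G , conjugate
      where
      conjugate : ∀ σ τ → G σ → Fixes τ → Fixes (flip σ ∘ₚ τ ∘ₚ σ)
      conjugate σ τ σ∈G τ-fixes i =
        trans (proj₁ (G-preserves σ σ∈G _ _) (τ-fixes (σ ⟨$⟩ˡ i))) (cong A (inverseʳ σ))

    fixator-splits : Splits Fixes G
    fixator-splits =
        canonical
      , (λ σ σ∈G → G-cosets σ (canonical σ) (sym ∘ canonical-colour σ) σ∈G)
      , (λ σ τ _ _ coset → canonical-coset σ τ (coset⇒sameColouring σ τ coset))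
      , (λ σ τ _ τ∈G → canonical-∘ σ τ (G-preserves τ τ∈G))
      , (λ σ _ → sameColouring⇒coset (canonical σ) σ (canonical-colour σ))

module AffineMod (n : ℕ) .{{_ : NonZero n}} where

  mod-difference : (x d : ℕ) → x % n ≡ (x + d) % n → n ∣ d
  mod-difference x d same = divides ((x + d) / n ∸ x / n) (begin
      d                                                       ≡⟨ sym (m+n∸m≡n x d) ⟩
      (x + d) ∸ x                                             ≡⟨ cong₂ _∸_ (m≡m%n+[m/n]*n (x + d) n) (m≡m%n+[m/n]*n x n) ⟩
      ((x + d) % n + (x + d) / n * n) ∸ (x % n + x / n * n)  ≡⟨ cong (λ r → (r + (x + d) / n * n) ∸ (x % n + x / n * n)) (sym same) ⟩
      (x % n + (x + d) / n * n) ∸ (x % n + x / n * n)        ≡⟨ [m+n]∸[m+o]≡n∸o (x % n) _ _ ⟩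
      (x + d) / n * n ∸ x / n * n                             ≡⟨ sym (*-distribʳ-∸ n ((x + d) / n) (x / n)) ⟩
      ((x + d) / n ∸ x / n) * n                               ∎)
    where open ≡-Reasoning

  affine-cong : (k c u u′ : ℕ) → u % n ≡ u′ % n → (k * u + c) % n ≡ (k * u′ + c) % n
  affine-cong k c u u′ same = begin
      (k * u + c) % n                          ≡⟨ %-distribˡ-+ (k * u) c n ⟩
      ((k * u) % n + c % n) % n                ≡⟨ cong (λ r → (r + c % n) % n) (%-distribˡ-* k u n) ⟩
      ((k % n * (u % n)) % n + c % n) % n      ≡⟨ cong (λ r → ((k % n * r) % n + c % n) % n) same ⟩
      ((k % n * (u′ % n)) % n + c % n) % n     ≡⟨ cong (λ r → (r + c % n) % n) (sym (%-distribˡ-* k u′ n)) ⟩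
      ((k * u′) % n + c % n) % n               ≡⟨ sym (%-distribˡ-+ (k * u′) c n) ⟩
      (k * u′ + c) % n                         ∎
    where open ≡-Reasoning

  private
    affine-injective-≤ : (k c u u′ : ℕ) → Coprime k n → u ≤ u′ →
      (k * u + c) % n ≡ (k * u′ + c) % n → u % n ≡ u′ % n
    affine-injective-≤ k c u u′ coprime u≤u′ same = begin
        u % n                ≡⟨ sym (%-remove-+ʳ u n∣gap) ⟩
        (u + (u′ ∸ u)) % n   ≡⟨ cong (_% n) (m+[n∸m]≡n u≤u′) ⟩
        u′ % n               ∎
      where
      open ≡-Reasoning
      distribute : ∀ k u g c → k * (u + g) + c ≡ (k * u + c) + k * g
      distribute = solve-∀
      shifted : (k * u + c) % n ≡ ((k * u + c) + k * (u′ ∸ u)) % n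
      shifted = trans same (cong (_% n) (trans (cong (λ w → k * w + c) (sym (m+[n∸m]≡n u≤u′)))
                                                (distribute k u (u′ ∸ u) c)))
      n∣gap : n ∣ u′ ∸ u
      n∣gap = coprime-divisor (Coprimality.sym coprime) (mod-difference (k * u + c) (k * (u′ ∸ u)) shifted)

  -- For k coprime to n, k u + c ≡ k u′ + c forces u ≡ u′ (cancel c, then k by Euclid).
  affine-injective : (k c u u′ : ℕ) → Coprime k n →
    (k * u + c) % n ≡ (k * u′ + c) % n → u % n ≡ u′ % n
  affine-injective k c u u′ coprime same with ≤-total u u′
  ... | inj₁ u≤u′ = affine-injective-≤ k c u u′ coprime u≤u′ same
  ... | inj₂ u′≤u = sym (affine-injective-≤ k c u′ u coprime u′≤u (sym same))

module Stabiliser (n : ℕ) .{{_ : NonZero n}} (a : Tuple n) where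
  open AffineMod n

  -- a reduced modulo n; S' n a is exactly the fixator of this colouring.
  residues : Colouring n
  residues i = a i % n

  open CanonicalSection residues

  Sbar-affine : ∀ σ → (σ∈Sbar : Sbar n a σ) →
    let (k , _ , c , _) = σ∈Sbar in ∀ x → residues x ≡ (k * a (σ ⟨$⟩ʳ x) + c) % n
  Sbar-affine σ (k , _ , c , ˢa≡ka+c) x =
    trans (cong residues (sym (inverseˡ σ))) (ˢa≡ka+c (σ ⟨$⟩ʳ x))

  Sbar-preserves : ∀ σ → Sbar n a σ → Preserves σ
  Sbar-preserves σ σ∈Sbar@(k , coprime , c , _) x y =
      (λ same → affine-injective k c _ _ coprime (trans (sym (affine x)) (trans same (affine y))))
    , (λ same → trans (affine x) (trans (affine-cong k c _ _ same) (sym (affine y))))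
    where affine = Sbar-affine σ σ∈Sbar

  Sbar-cosets : ∀ σ τ → SameColouring σ τ → Sbar n a σ → Sbar n a τ
  Sbar-cosets σ τ same σ∈Sbar@(k , coprime , c , _) = k , coprime , c , λ i → begin
      residues (τ ⟨$⟩ˡ i)                              ≡⟨ Sbar-affine σ σ∈Sbar (τ ⟨$⟩ˡ i) ⟩
      (k * a (σ ⟨$⟩ʳ (τ ⟨$⟩ˡ i)) + c) % n             ≡⟨ affine-cong k c _ _ (same (τ ⟨$⟩ˡ i)) ⟩
      (k * a (τ ⟨$⟩ʳ (τ ⟨$⟩ˡ i)) + c) % n             ≡⟨ cong (λ j → (k * a j + c) % n) (inverseʳ τ) ⟩
      (k * a i + c) % n                                ∎
    where open ≡-Reasoning

  S'⊆Sbar : ∀ τ → S' n a τ → Sbar n a τ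
  S'⊆Sbar τ fixes = 1 , 1-coprimeTo n , 0 , λ i →
    trans (fixes i) (cong (_% n) (sym (trans (+-identityʳ _) (*-identityˡ _))))

  normal : IsNormalIn (S' n a) (Sbar n a)
  normal = fixator-normal (Sbar n a) Sbar-preserves Sbar-cosets S'⊆Sbar

  splits : Splits (S' n a) (Sbar n a)
  splits = fixator-splits (Sbar n a) Sbar-preserves Sbar-cosets

theorem5p7 : (n : ℕ) → .{{_ : NonZero n}} → 3 ≤ n → (a : Tuple n) → SumZero n a →
    IsNormalIn (S' n a) (Sbar n a) × Splits (S' n a) (Sbar n a)
theorem5p7 n _ a _ = Stabiliser.normal n a , Stabiliser.splits n a
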